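{- Let $H_1$ be a graph whose complement $\overline{H_1}$ contains $S_4$ as a subgraph, and let $H_2$ be a graph of order $m\geq 5$. If $G=H_1\cup H_2$ is the disjoint union of $H_1$ and $H_2$, then either $\overline{G}$ contains $W_8$, or $H_2$ is $K_m$ or $K_m-e$ for some edge $e$ of $K_m$.
   Context: Graphs are finite and simple; $\overline{G}$ denotes the complement of $G$. $S_4$ is the star of order 4 (i.e. $K_{1,3}$). $W_8$ is the wheel of order 9, a hub joined to every vertex of a cycle $C_8$. $K_m-e$ is the complete graph $K_m$ with one edge removed. -}

module Defs where

open import Data.Nat using (ℕ; _+_)
open import Data.Fin using (Fin; splitAt; zero; suc)
open import Data.Bool using (Bool; true; false; not; _∧_; _∨_)
open import Data.Bool.Properties using (∨-comm)
open import Data.Nat using (suc; _≡ᵇ_)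
open import Data.Fin using (toℕ)
open import Data.Sum using (_⊎_; inj₁; inj₂)
open import Data.Product using (Σ; _×_; _,_; ∃-syntax)
open import Relation.Binary.PropositionalEquality using (_≡_; refl; trans; cong)
open import Relation.Nullary using (¬_)
open import Function.Definitions using (Injective)

record Graph (n : ℕ) : Set where
  field
    adj   : Fin n → Fin n → Bool
    adj-sym   : ∀ x y → adj x y ≡ adj y x
    adj-irrefl : ∀ x → adj x x ≡ false
open Graph public

Adj : ∀ {n} → Graph n → Fin n → Fin n → Set
Adj G x y = adj G x y ≡ true

complement : ∀ {n} → Graph n → Graph n
complement {n} G = record { adj = a ; adj-sym = s ; adj-irrefl = i }
  where
  open import Data.Fin using (_≟_)
  open import Relation.Nullary using (yes; no)
  open import Relation.Binary.PropositionalEquality using (sym)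
  a : Fin n → Fin n → Bool
  a x y with x ≟ y
  ... | yes _ = false
  ... | no _  = not (adj G x y)
  s : ∀ x y → a x y ≡ a y x
  s x y with x ≟ y | y ≟ x
  ... | yes _ | yes _ = refl
  ... | yes p | no q = Data.Empty.⊥-elim (q (sym p))
    where import Data.Empty
  ... | no q | yes p = Data.Empty.⊥-elim (q (sym p))
    where import Data.Empty
  ... | no _ | no _ = cong not (adj-sym G x y)
  i : ∀ x → a x x ≡ false
  i x with x ≟ x
  ... | yes _ = refl
  ... | no q = Data.Empty.⊥-elim (q refl)
    where import Data.Empty

disjointUnion : ∀ {n₁ n₂} → Graph n₁ → Graph n₂ → Graph (n₁ + n₂)
disjointUnion {n₁} {n₂} G₁ G₂ = record { adj = a ; adj-sym = s ; adj-irrefl = i }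
  where
  b : Fin n₁ ⊎ Fin n₂ → Fin n₁ ⊎ Fin n₂ → Bool
  b (inj₁ x) (inj₁ y) = adj G₁ x y
  b (inj₂ x) (inj₂ y) = adj G₂ x y
  b (inj₁ _) (inj₂ _) = false
  b (inj₂ _) (inj₁ _) = false
  a : Fin (n₁ + n₂) → Fin (n₁ + n₂) → Bool
  a x y = b (splitAt n₁ x) (splitAt n₁ y)
  bs : ∀ u v → b u v ≡ b v u
  bs (inj₁ x) (inj₁ y) = adj-sym G₁ x y
  bs (inj₂ x) (inj₂ y) = adj-sym G₂ x y
  bs (inj₁ _) (inj₂ _) = refl
  bs (inj₂ _) (inj₁ _) = refl
  s : ∀ x y → a x y ≡ a y x
  s x y = bs (splitAt n₁ x) (splitAt n₁ y)
  bi : ∀ u → b u u ≡ false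
  bi (inj₁ x) = adj-irrefl G₁ x
  bi (inj₂ x) = adj-irrefl G₂ x
  i : ∀ x → a x x ≡ false
  i x = bi (splitAt n₁ x)

_⊆G_ : ∀ {k n} → Graph k → Graph n → Set
_⊆G_ {k} {n} F G =
  Σ (Fin k → Fin n) λ f →
    Injective _≡_ _≡_ f × (∀ x y → Adj F x y → Adj G (f x) (f y))

symGraph : ∀ {n} (e : Fin n → Fin n → Bool) → (∀ x → e x x ≡ false) → Graph n
symGraph e ex = record
  { adj = λ x y → e x y ∨ e y x
  ; adj-sym = λ x y → ∨-comm (e x y) (e y x)
  ; adj-irrefl = λ x → trans (cong (λ b → b ∨ b) (ex x)) refl }

-- S₄ = K_{1,3}: vertex 0 is the centre, joined to 1, 2, 3.
starEdge : Fin 4 → Fin 4 → Bool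
starEdge x y = (toℕ x ≡ᵇ 0) ∧ not (toℕ y ≡ᵇ 0)

S₄ : Graph 4
S₄ = symGraph starEdge λ { zero → refl ; (suc x) → refl }

-- W₈: hub 0 joined to all of 1..8; rim cycle 1-2-3-4-5-6-7-8-1.
wheelEdge : Fin 9 → Fin 9 → Bool
wheelEdge x y =
  ((toℕ x ≡ᵇ 0) ∧ not (toℕ y ≡ᵇ 0))
  ∨ (not (toℕ x ≡ᵇ 0) ∧ (toℕ y ≡ᵇ suc (toℕ x)))
  ∨ ((toℕ x ≡ᵇ 8) ∧ (toℕ y ≡ᵇ 1))

W₈ : Graph 9
W₈ = symGraph wheelEdge λ
  { zero → refl ; (suc zero) → refl ; (suc (suc zero)) → refl
  ; (suc (suc (suc zero))) → refl ; (suc (suc (suc (suc zero)))) → refl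
  ; (suc (suc (suc (suc (suc zero))))) → refl
  ; (suc (suc (suc (suc (suc (suc zero)))))) → refl
  ; (suc (suc (suc (suc (suc (suc (suc zero))))))) → refl
  ; (suc (suc (suc (suc (suc (suc (suc (suc zero)))))))) → refl }

IsComplete : ∀ {m} → Graph m → Set
IsComplete {m} H = ∀ (x y : Fin m) → ¬ (x ≡ y) → Adj H x y

IsCompleteMinusEdge : ∀ {m} → Graph m → Set
IsCompleteMinusEdge {m} H =
  Σ (Fin m) λ u → Σ (Fin m) λ v → ¬ (u ≡ v) ×
    (¬ Adj H u v) ×
    (∀ (x y : Fin m) → ¬ (x ≡ y) →
       ¬ (x ≡ u × y ≡ v) → ¬ (x ≡ v × y ≡ u) → Adj H x y)

-- Let c be the centre and a, b, d the leaves of the S₄ in the complement of H₁.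
-- In the complement of H₁ ∪ H₂ every vertex of H₁ is joined to every vertex of
-- H₂, so c can serve as the hub of a wheel whose rim visits a, b, d with runs
-- of H₂-vertices in between; consecutive H₂-vertices on the rim must be
-- non-adjacent in H₂.  If H₂ is neither K_m nor K_m − e, its complement has two
-- distinct edges, forming a path y w z or a matching p q, r s; with m ≥ 5
-- spare vertices the rims  a x₁ b x₂ d y w z  and  a x b p q d r s  close up.
module Submission where

open import Defs
open import Data.Nat using (ℕ; _+_; _≥_; _<_)
open import Data.Nat.DivMod using (_mod_)
open import Data.Nat.Properties using (≤-trans; n≤1+n; <⇒≱)
open import Data.Fin using (Fin; zero; suc; toℕ; join; splitAt; _≟_)
open import Data.Fin.Patterns using (0F; 1F; 2F; 3F; 4F; 5F; 6F; 7F)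
open import Data.Fin.Properties using (any?; all?; suc-injective; splitAt-join; injective⇒≤)
open import Data.Vec.Functional using ([]; _∷_)
open import Data.Sum using (_⊎_; inj₁; inj₂; map; map₁)
open import Data.Sum.Properties using (≡-dec; inj₁-injective; inj₂-injective)
open import Data.Product using (_×_; _,_; ∃-syntax; proj₁; proj₂)
open import Data.Bool using (true; false)
open import Data.Empty using (⊥-elim)
open import Function using (_∘_)
open import Function.Definitions using (Injective)
open import Relation.Binary.Definitions using (DecidableEquality)
open import Relation.Nullary using (¬_; Dec; yes; no; contradiction)
open import Relation.Nullary.Decidable using (¬?; _×-dec_; _⊎-dec_; _→-dec_; map′; from-yes; decidable-stable)
open import Relation.Binary.PropositionalEquality using (_≡_; _≢_; refl; sym; trans; cong)

Adj-sym : ∀ {n} (G : Graph n) {x y} → Adj G x y → Adj G y x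
Adj-sym G {x} {y} e = trans (adj-sym G y x) e

Adj⇒≢ : ∀ {n} (G : Graph n) {x y} → Adj G x y → x ≢ y
Adj⇒≢ G {x} e refl with () ← trans (sym (adj-irrefl G x)) e

adj? : ∀ {n} (G : Graph n) x y → Dec (Adj G x y)
adj? G x y = adj G x y Data.Bool.≟ true
  where import Data.Bool

complement⁺ : ∀ {n} (G : Graph n) {x y} → x ≢ y → ¬ Adj G x y → Adj (complement G) x y
complement⁺ G {x} {y} x≢y ¬xy with x ≟ y
... | yes x≡y = contradiction x≡y x≢y
... | no _ with adj G x y
...   | true  = contradiction refl ¬xy
...   | false = refl

complement⁻ : ∀ {n} (G : Graph n) {x y} → Adj (complement G) x y → ¬ Adj G x y
complement⁻ G {x} {y} e xy with x ≟ y
complement⁻ G {x} {y} () xy | yes _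
... | no _ with adj G x y
complement⁻ G {x} {y} () refl | no _ | true

injective? : ∀ {n} {B : Set} → DecidableEquality B → (f : Fin n → B) → Dec (Injective _≡_ _≡_ f)
injective? _≟ᴮ_ f =
  map′ (λ inj {x} {y} → inj x y) (λ inj x y → inj {x} {y})
       (all? λ x → all? λ y → (f x ≟ᴮ f y) →-dec (x ≟ y))

[]-injective : ∀ {A : Set} → Injective _≡_ _≡_ ([] {A = A})
[]-injective {x = ()}

∷-injective : ∀ {n} {A : Set} {z : A} {p : Fin n → A} →
  (∀ i → z ≢ p i) → Injective _≡_ _≡_ p → Injective _≡_ _≡_ (z ∷ p)
∷-injective z∉p p-inj {zero}  {zero}  _ = refl
∷-injective z∉p p-inj {zero}  {suc j} e = contradiction e (z∉p j)
∷-injective z∉p p-inj {suc i} {zero}  e = contradiction (sym e) (z∉p i)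
∷-injective z∉p p-inj {suc i} {suc j} e = cong suc (p-inj e)

map-injective : ∀ {A B C D : Set} {f : A → C} {g : B → D} →
  Injective _≡_ _≡_ f → Injective _≡_ _≡_ g → Injective _≡_ _≡_ (map f g)
map-injective f-inj g-inj {inj₁ _} {inj₁ _} e = cong inj₁ (f-inj (inj₁-injective e))
map-injective f-inj g-inj {inj₂ _} {inj₂ _} e = cong inj₂ (g-inj (inj₂-injective e))
map-injective f-inj g-inj {inj₁ _} {inj₂ _} ()
map-injective f-inj g-inj {inj₂ _} {inj₁ _} ()

join-injective : ∀ n₁ m → Injective _≡_ _≡_ (join n₁ m)
join-injective n₁ m {u} {v} e =
  trans (sym (splitAt-join n₁ m u)) (trans (cong (splitAt n₁) e) (splitAt-join n₁ m v))

-- If every z had a preimage, choosing one would inject Fin m into Fin k.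
fresh : ∀ {k m} → k < m → (p : Fin k → Fin m) → ∃[ z ] (∀ i → z ≢ p i)
fresh {k} {m} k<m p with any? (λ z → all? λ i → ¬? (z ≟ p i))
... | yes found = found
... | no none = contradiction (injective⇒≤ section-injective) (<⇒≱ k<m)
  where
  preimage : ∀ z → ∃[ i ] z ≡ p i
  preimage z with any? (λ i → z ≟ p i)
  ... | yes found = found
  ... | no absent = ⊥-elim (none (z , λ i e → absent (i , e)))

  section-injective : Injective _≡_ _≡_ (proj₁ ∘ preimage)
  section-injective {x} {y} e =
    trans (proj₂ (preimage x)) (trans (cong p e) (sym (proj₂ (preimage y))))

extend : ∀ {k m} → k < m → (p : Fin k → Fin m) → Injective _≡_ _≡_ p →
  ∃[ z ] Injective _≡_ _≡_ (z ∷ p)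
extend k<m p p-inj with z , z∉p ← fresh k<m p = z , ∷-injective z∉p p-inj

next : Fin 8 → Fin 8
next i = (1 + toℕ i) mod 8

W₈-rim-adjacent : ∀ i j → Adj W₈ (suc i) (suc j) → j ≡ next i ⊎ i ≡ next j
W₈-rim-adjacent = from-yes
  (all? λ i → all? λ j → adj? W₈ (suc i) (suc j) →-dec ((j ≟ next i) ⊎-dec (i ≟ next j)))

wheel⊆ : ∀ {n} (F : Graph n) (hub : Fin n) (rim : Fin 8 → Fin n) →
  Injective _≡_ _≡_ rim → (∀ i → Adj F hub (rim i)) → (∀ i → Adj F (rim i) (rim (next i))) →
  W₈ ⊆G F
wheel⊆ F hub rim rim-inj spoke cycle =
  hub ∷ rim , ∷-injective (λ i → Adj⇒≢ F (spoke i)) rim-inj , edges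
  where
  edges : ∀ x y → Adj W₈ x y → Adj F ((hub ∷ rim) x) ((hub ∷ rim) y)
  edges zero    zero    ()
  edges zero    (suc j) _ = spoke j
  edges (suc i) zero    _ = Adj-sym F (spoke i)
  edges (suc i) (suc j) e with W₈-rim-adjacent i j e
  ... | inj₁ refl = cycle i
  ... | inj₂ refl = Adj-sym F (cycle j)

module _ {n₁ m} (H₁ : Graph n₁) (H₂ : Graph m) where

  data Apart : Fin n₁ ⊎ Fin m → Fin n₁ ⊎ Fin m → Set where
    left    : ∀ {x y} → Adj (complement H₁) x y → Apart (inj₁ x) (inj₁ y)
    right   : ∀ {x y} → Adj (complement H₂) x y → Apart (inj₂ x) (inj₂ y)
    across  : ∀ {x y} → Apart (inj₁ x) (inj₂ y)
    across′ : ∀ {x y} → Apart (inj₂ x) (inj₁ y)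

  Apart⇒≢ : ∀ {u v} → Apart u v → u ≢ v
  Apart⇒≢ (left {x} e)  refl = Adj⇒≢ (complement H₁) {x} e refl
  Apart⇒≢ (right {x} e) refl = Adj⇒≢ (complement H₂) {x} e refl

  Apart⇒¬Adj : ∀ {u v} → Apart u v → ¬ Adj (disjointUnion H₁ H₂) (join n₁ m u) (join n₁ m v)
  Apart⇒¬Adj (left {x} {y} e)
    rewrite splitAt-join n₁ m (inj₁ x) | splitAt-join n₁ m (inj₁ y) = complement⁻ H₁ e
  Apart⇒¬Adj (right {x} {y} e)
    rewrite splitAt-join n₁ m (inj₂ x) | splitAt-join n₁ m (inj₂ y) = complement⁻ H₂ e
  Apart⇒¬Adj (across {x} {y})
    rewrite splitAt-join n₁ m (inj₁ x) | splitAt-join n₁ m (inj₂ y) = λ ()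
  Apart⇒¬Adj (across′ {x} {y})
    rewrite splitAt-join n₁ m (inj₂ x) | splitAt-join n₁ m (inj₁ y) = λ ()

  Apart⇒Adj : ∀ {u v} → Apart u v →
    Adj (complement (disjointUnion H₁ H₂)) (join n₁ m u) (join n₁ m v)
  Apart⇒Adj a =
    complement⁺ (disjointUnion H₁ H₂) (Apart⇒≢ a ∘ join-injective n₁ m) (Apart⇒¬Adj a)

data TwoNonEdges {m} (H : Graph m) : Set where
  path     : ∀ {y w z} → Adj (complement H) y w → Adj (complement H) w z → y ≢ z →
             TwoNonEdges H
  matching : ∀ {p q r s} → Adj (complement H) p q → Adj (complement H) r s →
             p ≢ r → p ≢ s → q ≢ r → q ≢ s → TwoNonEdges H

distinctNonEdges : ∀ {m} (H : Graph m) {u v x y} →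
  Adj (complement H) u v → Adj (complement H) x y →
  ¬ (x ≡ u × y ≡ v) → ¬ (x ≡ v × y ≡ u) → TwoNonEdges H
distinctNonEdges H {u} {v} {x} {y} uv xy ≢uv ≢vu with x ≟ u | x ≟ v | y ≟ u | y ≟ v
... | yes refl | _ | _ | _ =
  path {y = v} {w = u} {z = y} (Adj-sym (complement H) {u} uv) xy λ v≡y → ≢uv (refl , sym v≡y)
... | no _ | yes refl | _ | _ =
  path {y = u} {w = v} {z = y} uv xy λ u≡y → ≢vu (refl , sym u≡y)
... | no _ | no x≢v | yes refl | _ =
  path {y = v} {w = u} {z = x} (Adj-sym (complement H) {u} uv) (Adj-sym (complement H) {x} xy) (x≢v ∘ sym)
... | no x≢u | no _ | no _ | yes refl =
  path {y = u} {w = v} {z = x} uv (Adj-sym (complement H) {x} xy) (x≢u ∘ sym)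
... | no x≢u | no x≢v | no y≢u | no y≢v =
  matching {p = u} {q = v} {r = x} {s = y} uv xy (x≢u ∘ sym) (y≢u ∘ sym) (x≢v ∘ sym) (y≢v ∘ sym)

classify : ∀ {m} (H : Graph m) → TwoNonEdges H ⊎ IsComplete H ⊎ IsCompleteMinusEdge H
classify H with any? (λ u → any? λ v → ¬? (u ≟ v) ×-dec ¬? (adj? H u v))
... | no none = inj₂ (inj₁ λ x y x≢y →
      decidable-stable (adj? H x y) λ ¬xy → none (x , y , x≢y , ¬xy))
... | yes (u , v , u≢v , ¬uv)
  with any? (λ x → any? λ y → ¬? (x ≟ y) ×-dec ¬? ((x ≟ u) ×-dec (y ≟ v))
                              ×-dec ¬? ((x ≟ v) ×-dec (y ≟ u)) ×-dec ¬? (adj? H x y))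
...   | no none = inj₂ (inj₂ (u , v , u≢v , ¬uv , λ x y x≢y ≢uv ≢vu →
        decidable-stable (adj? H x y) λ ¬xy → none (x , y , x≢y , ≢uv , ≢vu , ¬xy)))
...   | yes (x , y , x≢y , ≢uv , ≢vu , ¬xy) =
        inj₁ (distinctNonEdges H (complement⁺ H u≢v ¬uv) (complement⁺ H x≢y ¬xy) ≢uv ≢vu)

-- Position i of the rim holds leaf k of the S₄ (inj₁ k) or the j-th chosen vertex of H₂ (inj₂ j).
pathLayout matchingLayout : Fin 8 → Fin 3 ⊎ Fin 5
pathLayout     = inj₁ 0F ∷ inj₂ 0F ∷ inj₁ 1F ∷ inj₂ 1F ∷ inj₁ 2F ∷ inj₂ 2F ∷ inj₂ 3F ∷ inj₂ 4F ∷ []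
matchingLayout = inj₁ 0F ∷ inj₂ 0F ∷ inj₁ 1F ∷ inj₂ 1F ∷ inj₂ 2F ∷ inj₁ 2F ∷ inj₂ 3F ∷ inj₂ 4F ∷ []

module _ {n₁ m} {H₁ : Graph n₁} {H₂ : Graph m} (S : S₄ ⊆G complement H₁) where

  private
    centre : Fin n₁
    centre = proj₁ S 0F

    leaf : Fin 3 → Fin n₁
    leaf = proj₁ S ∘ suc

    leaf-injective : Injective _≡_ _≡_ leaf
    leaf-injective = suc-injective ∘ proj₁ (proj₂ S)

  wheelAround : (h : Fin 5 → Fin m) → Injective _≡_ _≡_ h →
    (layout : Fin 8 → Fin 3 ⊎ Fin 5) → Injective _≡_ _≡_ layout →
    (∀ i → Apart H₁ H₂ (map leaf h (layout i)) (map leaf h (layout (next i)))) →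
    W₈ ⊆G complement (disjointUnion H₁ H₂)
  wheelAround h h-inj layout layout-inj rim-apart =
    wheel⊆ (complement (disjointUnion H₁ H₂))
      (join n₁ m (inj₁ centre)) (join n₁ m ∘ map leaf h ∘ layout)
      (layout-inj ∘ map-injective leaf-injective h-inj ∘ join-injective n₁ m)
      (Apart⇒Adj H₁ H₂ ∘ centre-apart ∘ layout)
      (Apart⇒Adj H₁ H₂ ∘ rim-apart)
    where
    centre-apart : ∀ u → Apart H₁ H₂ (inj₁ centre) (map leaf h u)
    centre-apart (inj₁ k) = left (proj₂ (proj₂ S) 0F (suc k) refl)
    centre-apart (inj₂ _) = across

  twoNonEdges⇒W₈ : m ≥ 5 → TwoNonEdges H₂ → W₈ ⊆G complement (disjointUnion H₁ H₂)
  twoNonEdges⇒W₈ m≥5 (path {y} {w} {z} yw wz y≢z) =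
    let t = y ∷ w ∷ z ∷ []
        t-inj = ∷-injective (λ { 0F → Adj⇒≢ (complement H₂) yw ; 1F → y≢z })
                  (∷-injective (λ { 0F → Adj⇒≢ (complement H₂) wz }) (∷-injective (λ ()) []-injective))
        (x₁ , x₁∷t-inj) = extend (≤-trans (n≤1+n 4) m≥5) t t-inj
        (x₂ , h-inj)    = extend m≥5 (x₁ ∷ t) x₁∷t-inj
    in wheelAround (x₂ ∷ x₁ ∷ t) h-inj
         pathLayout (from-yes (injective? (≡-dec _≟_ _≟_) pathLayout))
         λ { 0F → across ; 1F → across′ ; 2F → across ; 3F → across′
           ; 4F → across ; 5F → right yw ; 6F → right wz ; 7F → across′ }
  twoNonEdges⇒W₈ m≥5 (matching {p} {q} {r} {s} pq rs p≢r p≢s q≢r q≢s) =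
    let t = p ∷ q ∷ r ∷ s ∷ []
        t-inj = ∷-injective (λ { 0F → Adj⇒≢ (complement H₂) pq ; 1F → p≢r ; 2F → p≢s })
                  (∷-injective (λ { 0F → q≢r ; 1F → q≢s })
                    (∷-injective (λ { 0F → Adj⇒≢ (complement H₂) rs }) (∷-injective (λ ()) []-injective)))
        (x , h-inj) = extend m≥5 t t-inj
    in wheelAround (x ∷ t) h-inj
         matchingLayout (from-yes (injective? (≡-dec _≟_ _≟_) matchingLayout))
         λ { 0F → across ; 1F → across′ ; 2F → across ; 3F → right pq
           ; 4F → across′ ; 5F → across ; 6F → right rs ; 7F → across′ }

lemma3 : ∀ {n₁ m : ℕ} (H₁ : Graph n₁) (H₂ : Graph m) →
    S₄ ⊆G complement H₁ → m ≥ 5 →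
    (W₈ ⊆G complement (disjointUnion H₁ H₂)) ⊎ IsComplete H₂ ⊎ IsCompleteMinusEdge H₂
lemma3 H₁ H₂ S m≥5 = map₁ (twoNonEdges⇒W₈ S m≥5) (classify H₂)
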